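{- Let $t\geq 0$ be an integer and let $\mathcal{H}$ be an $FF_4$-hypergraph with $n=4t+3$ vertices. Then the number $e(\mathcal{H})$ of hyperedges of $\mathcal{H}$ satisfies $e(\mathcal{H})\leq \frac{1}{96}n(n-1)(n-3)(n+1)$.
   Context: An $FF_4$-hypergraph is a 4-uniform hypergraph (every hyperedge is a 4-element subset of the vertex set) such that every set of 5 vertices contains either 0 or exactly 2 hyperedges. -}

module Defs where

open import Data.Nat using (ℕ; zero; suc; _+_)
open import Data.Bool using (Bool; true; false; _∧_; _∨_; not; if_then_else_)
open import Data.Vec using (Vec; []; _∷_)
open import Data.List using (List; []; _∷_; map; _++_; length; filter)
open import Data.Fin.Subset using (Subset; ∣_∣)
open import Relation.Binary.PropositionalEquality using (_≡_)
open import Data.Sum using (_⊎_)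
open import Relation.Nullary.Decidable using (Dec)
open import Data.Bool.Properties using (T?)
open import Data.Bool using (T)

allSubsets : (n : ℕ) → List (Subset n)
allSubsets zero = [] ∷ []
allSubsets (suc n) = map (true ∷_) (allSubsets n) ++ map (false ∷_) (allSubsets n)

subsetB : ∀ {n} → Subset n → Subset n → Bool
subsetB [] [] = true
subsetB (x ∷ xs) (y ∷ ys) = (not x ∨ y) ∧ subsetB xs ys

record Hypergraph4 (n : ℕ) : Set where
  field
    edge    : Subset n → Bool
    uniform : ∀ S → edge S ≡ true → ∣ S ∣ ≡ 4

open Hypergraph4 public

edgesIn : ∀ {n} → Hypergraph4 n → Subset n → ℕ
edgesIn {n} H S = length (filter (λ U → T? (edge H U ∧ subsetB U S)) (allSubsets n))

numEdges : ∀ {n} → Hypergraph4 n → ℕ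
numEdges {n} H = length (filter (λ U → T? (edge H U)) (allSubsets n))

IsFF4 : ∀ {n} → Hypergraph4 n → Set
IsFF4 {n} H = ∀ (S : Subset n) → ∣ S ∣ ≡ 5 → (edgesIn H S ≡ 0) ⊎ (edgesIn H S ≡ 2)

-- Write d(T) for the number of edges containing a 3-set T and k(S) for the number of edges
-- inside a 5-set S. Double counting gives Σ d(T) = 4e, and Σ d(T)² counts the triples (T, U, V)
-- of a 3-set and two edges with T ⊆ U ∩ V: each edge contributes 4 with U = V, and each ordered
-- pair of distinct edges meeting in three vertices contributes 1. Such a pair spans exactly one
-- 5-set, so these pairs number Σ k(S)(k(S) − 1). In an FF₄-hypergraph k(S) ∈ {0, 2}, hence
-- Σ k(k − 1) = Σ k = (n − 4)e and Σ d² = ne. Summing (d − t)(d − t − 1) ≥ 0 over all 3-sets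
-- yields (2t + 1)·4e ≤ ne + t(t + 1)·C(n, 3), which for n = 4t + 3 is the claimed bound.
module Submission where

open import Algebra.Bundles using (CommutativeMonoid)
import Algebra.Properties.CommutativeSemigroup as CommSemigroupProperties
open import Data.Bool using (Bool; true; false; _∧_; T)
open import Data.Bool.Properties using (T?; ∧-zeroʳ; ∧-identityʳ; ∧-idem; ∧-assoc; ∧-commutativeMonoid)
open import Data.Fin.Subset using (Subset; ∣_∣; _∩_; _∪_; ∁; ⊤)
open import Data.Fin.Subset.Properties using (∣p∩q∣≤∣p∣; ∣p∩q∣≤∣q∣; ∣p∣≤n; ∣∁p∣≡n∸∣p∣; ∣⊤∣≡n; ∩-idem; ∪-idem)
open import Data.List using (List; []; _∷_; map; _++_; length; filter)
open import Data.Nat using (ℕ; zero; suc; _+_; _*_; _∸_; _≤_; _<_; _≡ᵇ_; z≤n; s≤s)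
open import Data.Nat.Combinatorics using (_C_; nC1≡n; nCk+nC[k+1]≡[n+1]C[k+1]; k>n⇒nCk≡0)
open import Data.Nat.Properties
open import Data.Nat.Solver using (module +-*-Solver)
open import Data.Product using (_×_; _,_)
open import Data.Sum using (_⊎_; inj₁; inj₂)
open import Data.Vec using ([]; _∷_)
open import Data.Vec.Properties using (∷-injectiveʳ)
open import Function using (_∘_)
open import Relation.Binary.PropositionalEquality
open import Relation.Nullary using (contradiction)

open import Defs

open +-*-Solver using (solve; _:=_; con; _:+_; _:*_)

private
  module ∧-Props = CommSemigroupProperties (CommutativeMonoid.commutativeSemigroup ∧-commutativeMonoid)
  module +-Props = CommSemigroupProperties +-commutativeSemigroup
  module *-Props = CommSemigroupProperties *-commutativeSemigroup

  variable
    A B : Set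
    n : ℕ

⟦_⟧ : Bool → ℕ
⟦ true ⟧  = 1
⟦ false ⟧ = 0

⟦⟧-∧ : ∀ a b → ⟦ a ∧ b ⟧ ≡ ⟦ a ⟧ * ⟦ b ⟧
⟦⟧-∧ true  b = sym (+-identityʳ ⟦ b ⟧)
⟦⟧-∧ false b = refl

⟦⟧-∧-∧ : ∀ a b c → ⟦ a ⟧ * (⟦ b ⟧ * ⟦ c ⟧) ≡ ⟦ a ∧ (b ∧ c) ⟧
⟦⟧-∧-∧ a b c = trans (cong (⟦ a ⟧ *_) (sym (⟦⟧-∧ b c))) (sym (⟦⟧-∧ a (b ∧ c)))

⟦⟧-idem : ∀ b → ⟦ b ⟧ * ⟦ b ⟧ ≡ ⟦ b ⟧
⟦⟧-idem b = trans (sym (⟦⟧-∧ b b)) (cong ⟦_⟧ (∧-idem b))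

⟦≡ᵇ∧⟧≡0 : ∀ m k b → (T b → m ≢ k) → ⟦ (m ≡ᵇ k) ∧ b ⟧ ≡ 0
⟦≡ᵇ∧⟧≡0 m k false _ = cong ⟦_⟧ (∧-zeroʳ (m ≡ᵇ k))
⟦≡ᵇ∧⟧≡0 m k true m≢k with m ≡ᵇ k | ≡ᵇ⇒≡ m k
... | false | _   = refl
... | true  | m≡k = contradiction (m≡k _) (m≢k _)

∑ : List A → (A → ℕ) → ℕ
∑ []       f = 0
∑ (x ∷ xs) f = f x + ∑ xs f

infix 5 ∑
syntax ∑ xs (λ x → e) = ∑[ x ∈ xs ] e

length-filter : (p : A → Bool) (xs : List A) →
  length (filter (λ x → T? (p x)) xs) ≡ ∑[ x ∈ xs ] ⟦ p x ⟧
length-filter p []       = refl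
length-filter p (x ∷ xs) with p x
... | true  = cong suc (length-filter p xs)
... | false = length-filter p xs

∑-cong : (xs : List A) {f g : A → ℕ} → (∀ x → f x ≡ g x) → ∑ xs f ≡ ∑ xs g
∑-cong []       f≡g = refl
∑-cong (x ∷ xs) f≡g = cong₂ _+_ (f≡g x) (∑-cong xs f≡g)

∑-zero : (xs : List A) {f : A → ℕ} → (∀ x → f x ≡ 0) → ∑ xs f ≡ 0
∑-zero []       f≡0 = refl
∑-zero (x ∷ xs) f≡0 = cong₂ _+_ (f≡0 x) (∑-zero xs f≡0)

∑-mono-≤ : (xs : List A) {f g : A → ℕ} → (∀ x → f x ≤ g x) → ∑ xs f ≤ ∑ xs g
∑-mono-≤ []       f≤g = z≤n
∑-mono-≤ (x ∷ xs) f≤g = +-mono-≤ (f≤g x) (∑-mono-≤ xs f≤g)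

∑-++ : (xs ys : List A) (f : A → ℕ) → ∑ (xs ++ ys) f ≡ ∑ xs f + ∑ ys f
∑-++ []       ys f = refl
∑-++ (x ∷ xs) ys f = trans (cong (f x +_) (∑-++ xs ys f)) (sym (+-assoc (f x) _ _))

∑-map : (g : A → B) (xs : List A) (f : B → ℕ) → ∑ (map g xs) f ≡ ∑[ x ∈ xs ] f (g x)
∑-map g []       f = refl
∑-map g (x ∷ xs) f = cong (f (g x) +_) (∑-map g xs f)

∑-distrib-+ : (xs : List A) (f g : A → ℕ) → ∑[ x ∈ xs ] (f x + g x) ≡ ∑ xs f + ∑ xs g
∑-distrib-+ []       f g = refl
∑-distrib-+ (x ∷ xs) f g =
  trans (cong (f x + g x +_) (∑-distrib-+ xs f g)) (+-Props.interchange (f x) (g x) _ _)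

*-distribˡ-∑ : (xs : List A) (c : ℕ) (f : A → ℕ) → c * ∑ xs f ≡ ∑[ x ∈ xs ] c * f x
*-distribˡ-∑ []       c f = *-zeroʳ c
*-distribˡ-∑ (x ∷ xs) c f = trans (*-distribˡ-+ c (f x) _) (cong (c * f x +_) (*-distribˡ-∑ xs c f))

*-distribʳ-∑ : (xs : List A) (c : ℕ) (f : A → ℕ) → ∑ xs f * c ≡ ∑[ x ∈ xs ] f x * c
*-distribʳ-∑ []       c f = refl
*-distribʳ-∑ (x ∷ xs) c f = trans (*-distribʳ-+ c (f x) _) (cong (f x * c +_) (*-distribʳ-∑ xs c f))

∑-comm : (xs : List A) (ys : List B) (f : A → B → ℕ) →
  ∑[ x ∈ xs ] ∑[ y ∈ ys ] f x y ≡ ∑[ y ∈ ys ] ∑[ x ∈ xs ] f x y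
∑-comm []       ys f = sym (∑-zero ys (λ _ → refl))
∑-comm (x ∷ xs) ys f =
  trans (cong (∑ ys (f x) +_) (∑-comm xs ys f)) (sym (∑-distrib-+ ys (f x) (λ y → ∑[ x′ ∈ xs ] f x′ y)))

∑*∑ : (xs : List A) (ys : List B) (f : A → ℕ) (g : B → ℕ) →
  ∑ xs f * ∑ ys g ≡ ∑[ x ∈ xs ] ∑[ y ∈ ys ] f x * g y
∑*∑ xs ys f g = trans (*-distribʳ-∑ xs (∑ ys g) f) (∑-cong xs (λ x → *-distribˡ-∑ ys (f x) g))

double-count : (xs : List A) (ys : List B) (w : A → ℕ) (a : B → ℕ) (J : B → A → ℕ) →
  ∑[ x ∈ xs ] w x * (∑[ y ∈ ys ] a y * J y x) ≡ ∑[ y ∈ ys ] a y * (∑[ x ∈ xs ] w x * J y x)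
double-count xs ys w a J = begin
  ∑[ x ∈ xs ] w x * (∑[ y ∈ ys ] a y * J y x)   ≡⟨ ∑-cong xs (λ x → *-distribˡ-∑ ys (w x) _) ⟩
  ∑[ x ∈ xs ] ∑[ y ∈ ys ] w x * (a y * J y x)   ≡⟨ ∑-comm xs ys _ ⟩
  ∑[ y ∈ ys ] ∑[ x ∈ xs ] w x * (a y * J y x)   ≡⟨ ∑-cong ys (λ y → ∑-cong xs (λ x → *-Props.x∙yz≈y∙xz (w x) (a y) (J y x))) ⟩
  ∑[ y ∈ ys ] ∑[ x ∈ xs ] a y * (w x * J y x)   ≡⟨ ∑-cong ys (λ y → *-distribˡ-∑ xs (a y) _) ⟨
  ∑[ y ∈ ys ] a y * (∑[ x ∈ xs ] w x * J y x)   ∎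
  where open ≡-Reasoning

double-count² : (xs : List A) (ys : List B) (w : A → ℕ) (a : B → ℕ) (J : B → A → ℕ) →
  ∑[ x ∈ xs ] w x * ((∑[ y ∈ ys ] a y * J y x) * (∑[ z ∈ ys ] a z * J z x)) ≡
  ∑[ y ∈ ys ] ∑[ z ∈ ys ] (a y * a z) * (∑[ x ∈ xs ] w x * (J y x * J z x))
double-count² xs ys w a J = begin
  ∑[ x ∈ xs ] w x * ((∑[ y ∈ ys ] a y * J y x) * (∑[ z ∈ ys ] a z * J z x))
    ≡⟨ ∑-cong xs (λ x → cong (w x *_) (∑*∑ ys ys _ _)) ⟩
  ∑[ x ∈ xs ] w x * (∑[ y ∈ ys ] ∑[ z ∈ ys ] (a y * J y x) * (a z * J z x))
    ≡⟨ ∑-cong xs (λ x → trans (*-distribˡ-∑ ys (w x) _) (∑-cong ys (λ y → *-distribˡ-∑ ys (w x) _))) ⟩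
  ∑[ x ∈ xs ] ∑[ y ∈ ys ] ∑[ z ∈ ys ] w x * ((a y * J y x) * (a z * J z x))
    ≡⟨ trans (∑-comm xs ys _) (∑-cong ys (λ y → ∑-comm xs ys _)) ⟩
  ∑[ y ∈ ys ] ∑[ z ∈ ys ] ∑[ x ∈ xs ] w x * ((a y * J y x) * (a z * J z x))
    ≡⟨ ∑-cong ys (λ y → ∑-cong ys (λ z → ∑-cong xs (λ x → rearrange (w x) (a y) (J y x) (a z) (J z x)))) ⟩
  ∑[ y ∈ ys ] ∑[ z ∈ ys ] ∑[ x ∈ xs ] (a y * a z) * (w x * (J y x * J z x))
    ≡⟨ ∑-cong ys (λ y → ∑-cong ys (λ z → *-distribˡ-∑ xs (a y * a z) _)) ⟨
  ∑[ y ∈ ys ] ∑[ z ∈ ys ] (a y * a z) * (∑[ x ∈ xs ] w x * (J y x * J z x))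
    ∎
  where
  open ≡-Reasoning
  rearrange : ∀ w a j b k → w * ((a * j) * (b * k)) ≡ (a * b) * (w * (j * k))
  rearrange = solve 5 (λ w a j b k → w :* ((a :* j) :* (b :* k)) := (a :* b) :* (w :* (j :* k))) refl

∑-allSubsets-suc : (f : Subset (suc n) → ℕ) →
  ∑[ S ∈ allSubsets (suc n) ] f S ≡ (∑[ S ∈ allSubsets n ] f (true ∷ S)) + (∑[ S ∈ allSubsets n ] f (false ∷ S))
∑-allSubsets-suc {n} f =
  trans (∑-++ (map (true ∷_) (allSubsets n)) _ f) (cong₂ _+_ (∑-map _ (allSubsets n) f) (∑-map _ (allSubsets n) f))

∑-allSubsets-agree-except : (U : Subset n) (f g : Subset n → ℕ) → (∀ V → U ≢ V → f V ≡ g V) →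
  ∑ (allSubsets n) f + g U ≡ ∑ (allSubsets n) g + f U
∑-allSubsets-agree-except [] f g _ = +-Props.xy∙z≈zy∙x (f []) 0 (g [])
∑-allSubsets-agree-except {suc n} (true ∷ U) f g agree = begin
  ∑ (allSubsets (suc n)) f + g (true ∷ U)  ≡⟨ cong (_+ g (true ∷ U)) (∑-allSubsets-suc f) ⟩
  (F₁ + F₀) + g (true ∷ U)                 ≡⟨ +-Props.xy∙z≈xz∙y F₁ F₀ _ ⟩
  (F₁ + g (true ∷ U)) + F₀                 ≡⟨ cong₂ _+_ (∑-allSubsets-agree-except U _ _ (λ V U≢V → agree (true ∷ V) (U≢V ∘ ∷-injectiveʳ)))
                                                        (∑-cong (allSubsets n) (λ V → agree (false ∷ V) (λ ()))) ⟩
  (G₁ + f (true ∷ U)) + G₀                 ≡⟨ +-Props.xy∙z≈xz∙y G₁ G₀ _ ⟨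
  (G₁ + G₀) + f (true ∷ U)                 ≡⟨ cong (_+ f (true ∷ U)) (∑-allSubsets-suc g) ⟨
  ∑ (allSubsets (suc n)) g + f (true ∷ U)  ∎
  where
  open ≡-Reasoning
  F₁ = ∑[ V ∈ allSubsets n ] f (true ∷ V)
  F₀ = ∑[ V ∈ allSubsets n ] f (false ∷ V)
  G₁ = ∑[ V ∈ allSubsets n ] g (true ∷ V)
  G₀ = ∑[ V ∈ allSubsets n ] g (false ∷ V)
∑-allSubsets-agree-except {suc n} (false ∷ U) f g agree = begin
  ∑ (allSubsets (suc n)) f + g (false ∷ U) ≡⟨ cong (_+ g (false ∷ U)) (∑-allSubsets-suc f) ⟩
  (F₁ + F₀) + g (false ∷ U)                ≡⟨ +-assoc F₁ F₀ _ ⟩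
  F₁ + (F₀ + g (false ∷ U))                ≡⟨ cong₂ _+_ (∑-cong (allSubsets n) (λ V → agree (true ∷ V) (λ ())))
                                                        (∑-allSubsets-agree-except U _ _ (λ V U≢V → agree (false ∷ V) (U≢V ∘ ∷-injectiveʳ))) ⟩
  G₁ + (G₀ + f (false ∷ U))                ≡⟨ +-assoc G₁ G₀ _ ⟨
  (G₁ + G₀) + f (false ∷ U)                ≡⟨ cong (_+ f (false ∷ U)) (∑-allSubsets-suc g) ⟨
  ∑ (allSubsets (suc n)) g + f (false ∷ U) ∎
  where
  open ≡-Reasoning
  F₁ = ∑[ V ∈ allSubsets n ] f (true ∷ V)
  F₀ = ∑[ V ∈ allSubsets n ] f (false ∷ V)
  G₁ = ∑[ V ∈ allSubsets n ] g (true ∷ V)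
  G₀ = ∑[ V ∈ allSubsets n ] g (false ∷ V)

∑∑-agree-off-diagonal : (f g : Subset n → Subset n → ℕ) → (∀ U V → U ≢ V → f U V ≡ g U V) →
  (∑[ U ∈ allSubsets n ] ∑[ V ∈ allSubsets n ] f U V) + (∑[ U ∈ allSubsets n ] g U U) ≡
  (∑[ U ∈ allSubsets n ] ∑[ V ∈ allSubsets n ] g U V) + (∑[ U ∈ allSubsets n ] f U U)
∑∑-agree-off-diagonal {n} f g agree = begin
  (∑[ U ∈ allSubsets n ] ∑[ V ∈ allSubsets n ] f U V) + (∑[ U ∈ allSubsets n ] g U U)
    ≡⟨ ∑-distrib-+ (allSubsets n) _ _ ⟨
  ∑[ U ∈ allSubsets n ] (∑ (allSubsets n) (f U) + g U U)
    ≡⟨ ∑-cong (allSubsets n) (λ U → ∑-allSubsets-agree-except U (f U) (g U) (agree U)) ⟩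
  ∑[ U ∈ allSubsets n ] (∑ (allSubsets n) (g U) + f U U)
    ≡⟨ ∑-distrib-+ (allSubsets n) _ _ ⟩
  (∑[ U ∈ allSubsets n ] ∑[ V ∈ allSubsets n ] g U V) + (∑[ U ∈ allSubsets n ] f U U)
    ∎
  where open ≡-Reasoning

subsetB-∩ : (T U V : Subset n) → subsetB T (U ∩ V) ≡ subsetB T U ∧ subsetB T V
subsetB-∩ []          []      []      = refl
subsetB-∩ (true ∷ T)  (u ∷ U) (v ∷ V) = trans (cong ((u ∧ v) ∧_) (subsetB-∩ T U V)) (∧-Props.interchange u v _ _)
subsetB-∩ (false ∷ T) (u ∷ U) (v ∷ V) = subsetB-∩ T U V

subsetB-∪ : (U V S : Subset n) → subsetB (U ∪ V) S ≡ subsetB U S ∧ subsetB V S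
subsetB-∪ []          []          []          = refl
subsetB-∪ (false ∷ U) (false ∷ V) (s ∷ S)     = subsetB-∪ U V S
subsetB-∪ (true ∷ U)  (false ∷ V) (s ∷ S)     = trans (cong (s ∧_) (subsetB-∪ U V S)) (sym (∧-assoc s _ _))
subsetB-∪ (false ∷ U) (true ∷ V)  (s ∷ S)     = trans (cong (s ∧_) (subsetB-∪ U V S)) (∧-Props.x∙yz≈y∙xz s (subsetB U S) (subsetB V S))
subsetB-∪ (true ∷ U)  (true ∷ V)  (true ∷ S)  = subsetB-∪ U V S
subsetB-∪ (true ∷ U)  (true ∷ V)  (false ∷ S) = refl

subsetB-⊤ : (T : Subset n) → subsetB T ⊤ ≡ true
subsetB-⊤ []          = refl
subsetB-⊤ (true ∷ T)  = subsetB-⊤ T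
subsetB-⊤ (false ∷ T) = subsetB-⊤ T

subsetB⇒∣U∣≤∣S∣ : (U S : Subset n) → T (subsetB U S) → ∣ U ∣ ≤ ∣ S ∣
subsetB⇒∣U∣≤∣S∣ []          []          _    = z≤n
subsetB⇒∣U∣≤∣S∣ (true ∷ U)  (true ∷ S)  U⊆S = s≤s (subsetB⇒∣U∣≤∣S∣ U S U⊆S)
subsetB⇒∣U∣≤∣S∣ (false ∷ U) (true ∷ S)  U⊆S = m≤n⇒m≤1+n (subsetB⇒∣U∣≤∣S∣ U S U⊆S)
subsetB⇒∣U∣≤∣S∣ (false ∷ U) (false ∷ S) U⊆S = subsetB⇒∣U∣≤∣S∣ U S U⊆S

∣p∩q∣+∣p∪q∣≡∣p∣+∣q∣ : (p q : Subset n) → ∣ p ∩ q ∣ + ∣ p ∪ q ∣ ≡ ∣ p ∣ + ∣ q ∣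
∣p∩q∣+∣p∪q∣≡∣p∣+∣q∣ []          []          = refl
∣p∩q∣+∣p∪q∣≡∣p∣+∣q∣ (true ∷ p)  (true ∷ q)  =
  cong suc (trans (+-suc ∣ p ∩ q ∣ _) (trans (cong suc (∣p∩q∣+∣p∪q∣≡∣p∣+∣q∣ p q)) (sym (+-suc ∣ p ∣ _))))
∣p∩q∣+∣p∪q∣≡∣p∣+∣q∣ (true ∷ p)  (false ∷ q) = trans (+-suc ∣ p ∩ q ∣ _) (cong suc (∣p∩q∣+∣p∪q∣≡∣p∣+∣q∣ p q))
∣p∩q∣+∣p∪q∣≡∣p∣+∣q∣ (false ∷ p) (true ∷ q)  =
  trans (+-suc ∣ p ∩ q ∣ _) (trans (cong suc (∣p∩q∣+∣p∪q∣≡∣p∣+∣q∣ p q)) (sym (+-suc ∣ p ∣ _)))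
∣p∩q∣+∣p∪q∣≡∣p∣+∣q∣ (false ∷ p) (false ∷ q) = ∣p∩q∣+∣p∪q∣≡∣p∣+∣q∣ p q

∣p∩q∣≡∣p∣⇒∣p∩q∣≡∣q∣⇒p≡q : (p q : Subset n) → ∣ p ∩ q ∣ ≡ ∣ p ∣ → ∣ p ∩ q ∣ ≡ ∣ q ∣ → p ≡ q
∣p∩q∣≡∣p∣⇒∣p∩q∣≡∣q∣⇒p≡q []          []          _  _  = refl
∣p∩q∣≡∣p∣⇒∣p∩q∣≡∣q∣⇒p≡q (true ∷ p)  (true ∷ q)  ≡p ≡q =
  cong (true ∷_) (∣p∩q∣≡∣p∣⇒∣p∩q∣≡∣q∣⇒p≡q p q (suc-injective ≡p) (suc-injective ≡q))
∣p∩q∣≡∣p∣⇒∣p∩q∣≡∣q∣⇒p≡q (true ∷ p)  (false ∷ q) ≡p _  = contradiction (subst (_≤ ∣ p ∣) ≡p (∣p∩q∣≤∣p∣ p q)) 1+n≰n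
∣p∩q∣≡∣p∣⇒∣p∩q∣≡∣q∣⇒p≡q (false ∷ p) (true ∷ q)  _  ≡q = contradiction (subst (_≤ ∣ q ∣) ≡q (∣p∩q∣≤∣q∣ p q)) 1+n≰n
∣p∩q∣≡∣p∣⇒∣p∩q∣≡∣q∣⇒p≡q (false ∷ p) (false ∷ q) ≡p ≡q = cong (false ∷_) (∣p∩q∣≡∣p∣⇒∣p∩q∣≡∣q∣⇒p≡q p q ≡p ≡q)

subsetsOfSize : ℕ → Subset n → ℕ
subsetsOfSize {n} k W = ∑[ T ∈ allSubsets n ] ⟦ (∣ T ∣ ≡ᵇ k) ∧ subsetB T W ⟧

supersetsOfSize : ℕ → Subset n → ℕ
supersetsOfSize {n} k W = ∑[ S ∈ allSubsets n ] ⟦ (∣ S ∣ ≡ᵇ k) ∧ subsetB W S ⟧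

subsetsOfSize≡C : ∀ k (W : Subset n) → subsetsOfSize k W ≡ ∣ W ∣ C k
subsetsOfSize≡C zero    []          = refl
subsetsOfSize≡C (suc k) []          = refl
subsetsOfSize≡C {suc n} zero    (true ∷ W)  =
  trans (∑-allSubsets-suc {n} _) (cong₂ _+_ (∑-zero (allSubsets n) (λ _ → refl)) (subsetsOfSize≡C zero W))
subsetsOfSize≡C {suc n} (suc k) (true ∷ W)  =
  trans (∑-allSubsets-suc {n} _) (trans (cong₂ _+_ (subsetsOfSize≡C k W) (subsetsOfSize≡C (suc k) W))
                                    (nCk+nC[k+1]≡[n+1]C[k+1] ∣ W ∣ k))
subsetsOfSize≡C {suc n} k       (false ∷ W) =
  trans (∑-allSubsets-suc {n} _) (cong₂ _+_ (∑-zero (allSubsets n) (λ T → cong ⟦_⟧ (∧-zeroʳ _))) (subsetsOfSize≡C k W))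

∑⟦∣T∣≡ᵇk⟧≡nCk : ∀ n k → ∑[ T ∈ allSubsets n ] ⟦ ∣ T ∣ ≡ᵇ k ⟧ ≡ n C k
∑⟦∣T∣≡ᵇk⟧≡nCk n k = begin
  ∑[ T ∈ allSubsets n ] ⟦ ∣ T ∣ ≡ᵇ k ⟧ ≡⟨ ∑-cong (allSubsets n) within-⊤ ⟨
  subsetsOfSize {n} k ⊤                ≡⟨ subsetsOfSize≡C {n} k ⊤ ⟩
  ∣ ⊤ {n} ∣ C k                        ≡⟨ cong (_C k) (∣⊤∣≡n n) ⟩
  n C k                                ∎
  where
  open ≡-Reasoning
  within-⊤ : ∀ T → ⟦ (∣ T ∣ ≡ᵇ k) ∧ subsetB T ⊤ ⟧ ≡ ⟦ ∣ T ∣ ≡ᵇ k ⟧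
  within-⊤ T = cong ⟦_⟧ (trans (cong ((∣ T ∣ ≡ᵇ k) ∧_) (subsetB-⊤ T)) (∧-identityʳ _))

supersetsOfSize-< : ∀ k (W : Subset n) → k < ∣ W ∣ → supersetsOfSize k W ≡ 0
supersetsOfSize-< {n} k W k<∣W∣ = ∑-zero (allSubsets n) (λ S → ⟦≡ᵇ∧⟧≡0 ∣ S ∣ k (subsetB W S) (λ W⊆S ∣S∣≡k →
  <⇒≱ k<∣W∣ (subst (∣ W ∣ ≤_) ∣S∣≡k (subsetB⇒∣U∣≤∣S∣ W S W⊆S))))

supersetsOfSize≡C : ∀ j (W : Subset n) → supersetsOfSize (∣ W ∣ + j) W ≡ ∣ ∁ W ∣ C j
supersetsOfSize≡C zero    []          = refl
supersetsOfSize≡C (suc j) []          = refl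
supersetsOfSize≡C {suc n} j       (true ∷ W)  =
  trans (∑-allSubsets-suc {n} _) (trans (cong₂ _+_ (supersetsOfSize≡C j W) (∑-zero (allSubsets n) (λ S → cong ⟦_⟧ (∧-zeroʳ _))))
                                    (+-identityʳ _))
supersetsOfSize≡C {suc n} zero    (false ∷ W) =
  trans (∑-allSubsets-suc {n} _) (cong₂ _+_ (∑-zero (allSubsets n) too-large) (supersetsOfSize≡C zero W))
  where
  too-large : ∀ S → ⟦ (suc ∣ S ∣ ≡ᵇ ∣ W ∣ + 0) ∧ subsetB W S ⟧ ≡ 0
  too-large S = ⟦≡ᵇ∧⟧≡0 _ _ (subsetB W S) (λ W⊆S 1+∣S∣≡∣W∣ →
    1+n≰n (subst (_≤ ∣ S ∣) (sym (trans 1+∣S∣≡∣W∣ (+-identityʳ ∣ W ∣))) (subsetB⇒∣U∣≤∣S∣ W S W⊆S)))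
supersetsOfSize≡C {suc n} (suc j) (false ∷ W) =
  trans (∑-allSubsets-suc {n} _) (trans (cong₂ _+_ one-more (supersetsOfSize≡C (suc j) W)) (nCk+nC[k+1]≡[n+1]C[k+1] ∣ ∁ W ∣ j))
  where
  one-more : ∑[ S ∈ allSubsets n ] ⟦ (suc ∣ S ∣ ≡ᵇ ∣ W ∣ + suc j) ∧ subsetB W S ⟧ ≡ ∣ ∁ W ∣ C j
  one-more = trans (∑-cong (allSubsets n) (λ S → cong (λ m → ⟦ (suc ∣ S ∣ ≡ᵇ m) ∧ subsetB W S ⟧) (+-suc ∣ W ∣ j)))
                   (supersetsOfSize≡C j W)

supersetsOfSize[1+∣W∣]+∣W∣≡n : (W : Subset n) → supersetsOfSize (suc ∣ W ∣) W + ∣ W ∣ ≡ n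
supersetsOfSize[1+∣W∣]+∣W∣≡n {n} W = begin
  supersetsOfSize (suc ∣ W ∣) W + ∣ W ∣  ≡⟨ cong (λ k → supersetsOfSize k W + ∣ W ∣) (+-comm 1 ∣ W ∣) ⟩
  supersetsOfSize (∣ W ∣ + 1) W + ∣ W ∣  ≡⟨ cong (_+ ∣ W ∣) (trans (supersetsOfSize≡C 1 W) (nC1≡n _)) ⟩
  ∣ ∁ W ∣ + ∣ W ∣                        ≡⟨ cong (_+ ∣ W ∣) (∣∁p∣≡n∸∣p∣ W) ⟩
  n ∸ ∣ W ∣ + ∣ W ∣                      ≡⟨ m∸n+n≡m (∣p∣≤n W) ⟩
  n                                      ∎
  where open ≡-Reasoning

split-8 : ∀ {a b} → a + b ≡ 8 → a ≤ 3 → (a ≡ 3 × b ≡ 5) ⊎ (a < 3 × 5 < b)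
split-8 {a} {b} a+b≡8 a≤3 with m≤n⇒m<n∨m≡n a≤3
... | inj₂ refl = inj₁ (refl , +-cancelˡ-≡ 3 b 5 a+b≡8)
... | inj₁ a<3  = inj₂ (a<3 , +-cancelˡ-≤ 2 6 b (subst (_≤ 2 + b) a+b≡8 (+-monoˡ-≤ b (≤-pred a<3))))

distinct-4-sets : (U V : Subset n) → ∣ U ∣ ≡ 4 → ∣ V ∣ ≡ 4 → U ≢ V →
  (∣ U ∩ V ∣ ≡ 3 × ∣ U ∪ V ∣ ≡ 5) ⊎ (∣ U ∩ V ∣ < 3 × 5 < ∣ U ∪ V ∣)
distinct-4-sets U V ∣U∣≡4 ∣V∣≡4 U≢V = split-8 (trans (∣p∩q∣+∣p∪q∣≡∣p∣+∣q∣ U V) (cong₂ _+_ ∣U∣≡4 ∣V∣≡4)) ∣U∩V∣≤3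
  where
  ∣U∩V∣≢4 : ∣ U ∩ V ∣ ≢ 4
  ∣U∩V∣≢4 ≡4 = U≢V (∣p∩q∣≡∣p∣⇒∣p∩q∣≡∣q∣⇒p≡q U V (trans ≡4 (sym ∣U∣≡4)) (trans ≡4 (sym ∣V∣≡4)))
  ∣U∩V∣≤3 : ∣ U ∩ V ∣ ≤ 3
  ∣U∩V∣≤3 = ≤-pred (≤∧≢⇒< (subst (∣ U ∩ V ∣ ≤_) ∣U∣≡4 (∣p∩q∣≤∣p∣ U V)) ∣U∩V∣≢4)

∣U∩V∣C3≡supersetsOfSize5[U∪V] : (U V : Subset n) → ∣ U ∣ ≡ 4 → ∣ V ∣ ≡ 4 → U ≢ V →
  ∣ U ∩ V ∣ C 3 ≡ supersetsOfSize 5 (U ∪ V)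
∣U∩V∣C3≡supersetsOfSize5[U∪V] U V ∣U∣≡4 ∣V∣≡4 U≢V with distinct-4-sets U V ∣U∣≡4 ∣V∣≡4 U≢V
... | inj₁ (∣U∩V∣≡3 , ∣U∪V∣≡5) = begin
  ∣ U ∩ V ∣ C 3                            ≡⟨ cong (_C 3) ∣U∩V∣≡3 ⟩
  1                                        ≡⟨ supersetsOfSize≡C 0 (U ∪ V) ⟨
  supersetsOfSize (∣ U ∪ V ∣ + 0) (U ∪ V)  ≡⟨ cong (λ k → supersetsOfSize k (U ∪ V)) (trans (+-identityʳ _) ∣U∪V∣≡5) ⟩
  supersetsOfSize 5 (U ∪ V)                ∎
  where open ≡-Reasoning
... | inj₂ (∣U∩V∣<3 , 5<∣U∪V∣) = trans (k>n⇒nCk≡0 ∣U∩V∣<3) (sym (supersetsOfSize-< 5 (U ∪ V) 5<∣U∪V∣))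

[2t+1]d≤d²+t[t+1] : ∀ t d → (2 * t + 1) * d ≤ d * d + t * (t + 1)
[2t+1]d≤d²+t[t+1] t d with ≤-<-connex d t
... | inj₁ d≤t with m≤n⇒∃[o]m+o≡n d≤t
...   | j , refl = subst ((2 * (d + j) + 1) * d ≤_) (sym (expand d j)) (m≤m+n _ (j * (j + 1)))
  where
  expand : ∀ d j → d * d + (d + j) * ((d + j) + 1) ≡ (2 * (d + j) + 1) * d + j * (j + 1)
  expand = solve 2 (λ d j → d :* d :+ (d :+ j) :* ((d :+ j) :+ con 1) := (con 2 :* (d :+ j) :+ con 1) :* d :+ j :* (j :+ con 1)) refl
[2t+1]d≤d²+t[t+1] t d | inj₂ t<d with m≤n⇒∃[o]m+o≡n t<d
...   | i , refl = subst ((2 * t + 1) * (suc t + i) ≤_) (sym (expand t i)) (m≤m+n _ ((i + 1) * i))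
  where
  expand : ∀ t i → (suc t + i) * (suc t + i) + t * (t + 1) ≡ (2 * t + 1) * (suc t + i) + (i + 1) * i
  expand = solve 2 (λ t i → (con 1 :+ t :+ i) :* (con 1 :+ t :+ i) :+ t :* (t :+ con 1) := (con 2 :* t :+ con 1) :* (con 1 :+ t :+ i) :+ (i :+ con 1) :* i) refl

module _ {n : ℕ} (H : Hypergraph4 n) where

  codegree : Subset n → ℕ
  codegree T = ∑[ U ∈ allSubsets n ] ⟦ edge H U ⟧ * ⟦ subsetB T U ⟧

  numEdges≡∑ : numEdges H ≡ ∑[ U ∈ allSubsets n ] ⟦ edge H U ⟧
  numEdges≡∑ = length-filter (edge H) (allSubsets n)

  edgesIn≡∑ : ∀ S → edgesIn H S ≡ ∑[ U ∈ allSubsets n ] ⟦ edge H U ⟧ * ⟦ subsetB U S ⟧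
  edgesIn≡∑ S = trans (length-filter _ (allSubsets n)) (∑-cong (allSubsets n) (λ U → ⟦⟧-∧ (edge H U) (subsetB U S)))

  ⟦edge⟧*C : ∀ k U → ⟦ edge H U ⟧ * (∣ U ∣ C k) ≡ ⟦ edge H U ⟧ * (4 C k)
  ⟦edge⟧*C k U with edge H U in isEdge
  ... | false = refl
  ... | true  = cong (λ m → 1 * (m C k)) (uniform H U isEdge)

  ⟦edge⟧*[supersetsOfSize5+4] : ∀ U → ⟦ edge H U ⟧ * (supersetsOfSize 5 U + 4) ≡ ⟦ edge H U ⟧ * n
  ⟦edge⟧*[supersetsOfSize5+4] U with edge H U in isEdge
  ... | false = refl
  ... | true  = cong (1 *_) (subst (λ m → supersetsOfSize (suc m) U + m ≡ n) (uniform H U isEdge) (supersetsOfSize[1+∣W∣]+∣W∣≡n U))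

  ∑⟦edge⟧* : ∀ c → ∑[ U ∈ allSubsets n ] ⟦ edge H U ⟧ * c ≡ c * numEdges H
  ∑⟦edge⟧* c = begin
    ∑[ U ∈ allSubsets n ] ⟦ edge H U ⟧ * c  ≡⟨ *-distribʳ-∑ (allSubsets n) c _ ⟨
    (∑[ U ∈ allSubsets n ] ⟦ edge H U ⟧) * c ≡⟨ cong (_* c) numEdges≡∑ ⟨
    numEdges H * c                          ≡⟨ *-comm (numEdges H) c ⟩
    c * numEdges H                          ∎
    where open ≡-Reasoning

  ∑-codegree : ∀ k → ∑[ T ∈ allSubsets n ] ⟦ ∣ T ∣ ≡ᵇ k ⟧ * codegree T ≡ (4 C k) * numEdges H
  ∑-codegree k = begin
    ∑[ T ∈ allSubsets n ] ⟦ ∣ T ∣ ≡ᵇ k ⟧ * codegree T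
      ≡⟨ double-count (allSubsets n) (allSubsets n) (λ T → ⟦ ∣ T ∣ ≡ᵇ k ⟧) (λ U → ⟦ edge H U ⟧) (λ U T → ⟦ subsetB T U ⟧) ⟩
    ∑[ U ∈ allSubsets n ] ⟦ edge H U ⟧ * (∑[ T ∈ allSubsets n ] ⟦ ∣ T ∣ ≡ᵇ k ⟧ * ⟦ subsetB T U ⟧)
      ≡⟨ ∑-cong (allSubsets n) (λ U → cong (⟦ edge H U ⟧ *_) (subsets U)) ⟩
    ∑[ U ∈ allSubsets n ] ⟦ edge H U ⟧ * (∣ U ∣ C k)
      ≡⟨ ∑-cong (allSubsets n) (⟦edge⟧*C k) ⟩
    ∑[ U ∈ allSubsets n ] ⟦ edge H U ⟧ * (4 C k)
      ≡⟨ ∑⟦edge⟧* (4 C k) ⟩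
    (4 C k) * numEdges H
      ∎
    where
    open ≡-Reasoning
    subsets : ∀ U → ∑[ T ∈ allSubsets n ] ⟦ ∣ T ∣ ≡ᵇ k ⟧ * ⟦ subsetB T U ⟧ ≡ ∣ U ∣ C k
    subsets U = trans (∑-cong (allSubsets n) (λ T → sym (⟦⟧-∧ (∣ T ∣ ≡ᵇ k) (subsetB T U)))) (subsetsOfSize≡C k U)

  ∑-codegree² : ∀ k → ∑[ T ∈ allSubsets n ] ⟦ ∣ T ∣ ≡ᵇ k ⟧ * (codegree T * codegree T) ≡
    ∑[ U ∈ allSubsets n ] ∑[ V ∈ allSubsets n ] (⟦ edge H U ⟧ * ⟦ edge H V ⟧) * (∣ U ∩ V ∣ C k)
  ∑-codegree² k =
    trans (double-count² (allSubsets n) (allSubsets n) (λ T → ⟦ ∣ T ∣ ≡ᵇ k ⟧) (λ U → ⟦ edge H U ⟧) (λ U T → ⟦ subsetB T U ⟧))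
          (∑-cong (allSubsets n) (λ U → ∑-cong (allSubsets n) (λ V → cong ((⟦ edge H U ⟧ * ⟦ edge H V ⟧) *_) (common-subsets U V))))
    where
    common-subsets : ∀ U V → ∑[ T ∈ allSubsets n ] ⟦ ∣ T ∣ ≡ᵇ k ⟧ * (⟦ subsetB T U ⟧ * ⟦ subsetB T V ⟧) ≡ ∣ U ∩ V ∣ C k
    common-subsets U V = trans (∑-cong (allSubsets n) (λ T → trans (⟦⟧-∧-∧ (∣ T ∣ ≡ᵇ k) (subsetB T U) (subsetB T V))
                                                                  (cong (λ b → ⟦ (∣ T ∣ ≡ᵇ k) ∧ b ⟧) (sym (subsetB-∩ T U V)))))
                               (subsetsOfSize≡C k (U ∩ V))

  ∑-edgesIn : ∀ k → ∑[ S ∈ allSubsets n ] ⟦ ∣ S ∣ ≡ᵇ k ⟧ * edgesIn H S ≡ ∑[ U ∈ allSubsets n ] ⟦ edge H U ⟧ * supersetsOfSize k U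
  ∑-edgesIn k = begin
    ∑[ S ∈ allSubsets n ] ⟦ ∣ S ∣ ≡ᵇ k ⟧ * edgesIn H S
      ≡⟨ ∑-cong (allSubsets n) (λ S → cong (⟦ ∣ S ∣ ≡ᵇ k ⟧ *_) (edgesIn≡∑ S)) ⟩
    ∑[ S ∈ allSubsets n ] ⟦ ∣ S ∣ ≡ᵇ k ⟧ * (∑[ U ∈ allSubsets n ] ⟦ edge H U ⟧ * ⟦ subsetB U S ⟧)
      ≡⟨ double-count (allSubsets n) (allSubsets n) (λ S → ⟦ ∣ S ∣ ≡ᵇ k ⟧) (λ U → ⟦ edge H U ⟧) (λ U S → ⟦ subsetB U S ⟧) ⟩
    ∑[ U ∈ allSubsets n ] ⟦ edge H U ⟧ * (∑[ S ∈ allSubsets n ] ⟦ ∣ S ∣ ≡ᵇ k ⟧ * ⟦ subsetB U S ⟧)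
      ≡⟨ ∑-cong (allSubsets n) (λ U → cong (⟦ edge H U ⟧ *_) (∑-cong (allSubsets n) (λ S → sym (⟦⟧-∧ (∣ S ∣ ≡ᵇ k) (subsetB U S))))) ⟩
    ∑[ U ∈ allSubsets n ] ⟦ edge H U ⟧ * supersetsOfSize k U
      ∎
    where open ≡-Reasoning

  ∑-edgesIn² : ∀ k → ∑[ S ∈ allSubsets n ] ⟦ ∣ S ∣ ≡ᵇ k ⟧ * (edgesIn H S * edgesIn H S) ≡
    ∑[ U ∈ allSubsets n ] ∑[ V ∈ allSubsets n ] (⟦ edge H U ⟧ * ⟦ edge H V ⟧) * supersetsOfSize k (U ∪ V)
  ∑-edgesIn² k = begin
    ∑[ S ∈ allSubsets n ] ⟦ ∣ S ∣ ≡ᵇ k ⟧ * (edgesIn H S * edgesIn H S)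
      ≡⟨ ∑-cong (allSubsets n) (λ S → cong (λ m → ⟦ ∣ S ∣ ≡ᵇ k ⟧ * (m * m)) (edgesIn≡∑ S)) ⟩
    ∑[ S ∈ allSubsets n ] ⟦ ∣ S ∣ ≡ᵇ k ⟧ * ((∑[ U ∈ allSubsets n ] ⟦ edge H U ⟧ * ⟦ subsetB U S ⟧) * (∑[ V ∈ allSubsets n ] ⟦ edge H V ⟧ * ⟦ subsetB V S ⟧))
      ≡⟨ double-count² (allSubsets n) (allSubsets n) (λ S → ⟦ ∣ S ∣ ≡ᵇ k ⟧) (λ U → ⟦ edge H U ⟧) (λ U S → ⟦ subsetB U S ⟧) ⟩
    ∑[ U ∈ allSubsets n ] ∑[ V ∈ allSubsets n ] (⟦ edge H U ⟧ * ⟦ edge H V ⟧) * (∑[ S ∈ allSubsets n ] ⟦ ∣ S ∣ ≡ᵇ k ⟧ * (⟦ subsetB U S ⟧ * ⟦ subsetB V S ⟧))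
      ≡⟨ ∑-cong (allSubsets n) (λ U → ∑-cong (allSubsets n) (λ V → cong ((⟦ edge H U ⟧ * ⟦ edge H V ⟧) *_) (common-supersets U V))) ⟩
    ∑[ U ∈ allSubsets n ] ∑[ V ∈ allSubsets n ] (⟦ edge H U ⟧ * ⟦ edge H V ⟧) * supersetsOfSize k (U ∪ V)
      ∎
    where
    open ≡-Reasoning
    common-supersets : ∀ U V → ∑[ S ∈ allSubsets n ] ⟦ ∣ S ∣ ≡ᵇ k ⟧ * (⟦ subsetB U S ⟧ * ⟦ subsetB V S ⟧) ≡ supersetsOfSize k (U ∪ V)
    common-supersets U V = ∑-cong (allSubsets n) (λ S → trans (⟦⟧-∧-∧ (∣ S ∣ ≡ᵇ k) (subsetB U S) (subsetB V S))
                                                             (cong (λ b → ⟦ (∣ S ∣ ≡ᵇ k) ∧ b ⟧) (sym (subsetB-∪ U V S))))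

  FF4⇒⟦∣S∣≡ᵇ5⟧*edgesIn² : IsFF4 H → ∀ S → ⟦ ∣ S ∣ ≡ᵇ 5 ⟧ * (edgesIn H S * edgesIn H S) ≡ 2 * (⟦ ∣ S ∣ ≡ᵇ 5 ⟧ * edgesIn H S)
  FF4⇒⟦∣S∣≡ᵇ5⟧*edgesIn² ff S with ∣ S ∣ ≡ᵇ 5 | ≡ᵇ⇒≡ ∣ S ∣ 5
  ... | false | _      = refl
  ... | true  | ∣S∣≡5 with ff S (∣S∣≡5 _)
  ...   | inj₁ none rewrite none = refl
  ...   | inj₂ two  rewrite two  = refl

  ∑-edgesIn+4e≡n*e : (∑[ S ∈ allSubsets n ] ⟦ ∣ S ∣ ≡ᵇ 5 ⟧ * edgesIn H S) + 4 * numEdges H ≡ n * numEdges H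
  ∑-edgesIn+4e≡n*e = begin
    (∑[ S ∈ allSubsets n ] ⟦ ∣ S ∣ ≡ᵇ 5 ⟧ * edgesIn H S) + 4 * numEdges H
      ≡⟨ cong₂ _+_ (∑-edgesIn 5) (sym (∑⟦edge⟧* 4)) ⟩
    (∑[ U ∈ allSubsets n ] ⟦ edge H U ⟧ * supersetsOfSize 5 U) + (∑[ U ∈ allSubsets n ] ⟦ edge H U ⟧ * 4)
      ≡⟨ ∑-distrib-+ (allSubsets n) _ _ ⟨
    ∑[ U ∈ allSubsets n ] (⟦ edge H U ⟧ * supersetsOfSize 5 U + ⟦ edge H U ⟧ * 4)
      ≡⟨ ∑-cong (allSubsets n) (λ U → *-distribˡ-+ ⟦ edge H U ⟧ _ 4) ⟨
    ∑[ U ∈ allSubsets n ] ⟦ edge H U ⟧ * (supersetsOfSize 5 U + 4)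
      ≡⟨ ∑-cong (allSubsets n) ⟦edge⟧*[supersetsOfSize5+4] ⟩
    ∑[ U ∈ allSubsets n ] ⟦ edge H U ⟧ * n
      ≡⟨ ∑⟦edge⟧* n ⟩
    n * numEdges H
      ∎
    where open ≡-Reasoning

  ∑-codegree²+∑-edgesIn≡∑-edgesIn²+4e :
    (∑[ T ∈ allSubsets n ] ⟦ ∣ T ∣ ≡ᵇ 3 ⟧ * (codegree T * codegree T)) + (∑[ S ∈ allSubsets n ] ⟦ ∣ S ∣ ≡ᵇ 5 ⟧ * edgesIn H S) ≡
    (∑[ S ∈ allSubsets n ] ⟦ ∣ S ∣ ≡ᵇ 5 ⟧ * (edgesIn H S * edgesIn H S)) + 4 * numEdges H
  ∑-codegree²+∑-edgesIn≡∑-edgesIn²+4e = begin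
    (∑[ T ∈ allSubsets n ] ⟦ ∣ T ∣ ≡ᵇ 3 ⟧ * (codegree T * codegree T)) + (∑[ S ∈ allSubsets n ] ⟦ ∣ S ∣ ≡ᵇ 5 ⟧ * edgesIn H S)
      ≡⟨ cong₂ _+_ (∑-codegree² 3) (trans (∑-edgesIn 5) (sym (∑-cong (allSubsets n) g-diagonal))) ⟩
    (∑[ U ∈ allSubsets n ] ∑[ V ∈ allSubsets n ] f U V) + (∑[ U ∈ allSubsets n ] g U U)
      ≡⟨ ∑∑-agree-off-diagonal f g f≡g-off-diagonal ⟩
    (∑[ U ∈ allSubsets n ] ∑[ V ∈ allSubsets n ] g U V) + (∑[ U ∈ allSubsets n ] f U U)
      ≡⟨ cong₂ _+_ (∑-edgesIn² 5) (sym (trans (∑-cong (allSubsets n) f-diagonal) (∑⟦edge⟧* 4))) ⟨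
    (∑[ S ∈ allSubsets n ] ⟦ ∣ S ∣ ≡ᵇ 5 ⟧ * (edgesIn H S * edgesIn H S)) + 4 * numEdges H
      ∎
    where
    open ≡-Reasoning
    f g : Subset n → Subset n → ℕ
    f U V = (⟦ edge H U ⟧ * ⟦ edge H V ⟧) * (∣ U ∩ V ∣ C 3)
    g U V = (⟦ edge H U ⟧ * ⟦ edge H V ⟧) * supersetsOfSize 5 (U ∪ V)

    f≡g-off-diagonal : ∀ U V → U ≢ V → f U V ≡ g U V
    f≡g-off-diagonal U V U≢V with edge H U in isEdgeU | edge H V in isEdgeV
    ... | true  | true  = cong (1 *_) (∣U∩V∣C3≡supersetsOfSize5[U∪V] U V (uniform H U isEdgeU) (uniform H V isEdgeV) U≢V)
    ... | true  | false = refl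
    ... | false | _     = refl

    f-diagonal : ∀ U → f U U ≡ ⟦ edge H U ⟧ * 4
    f-diagonal U = trans (cong₂ _*_ (⟦⟧-idem (edge H U)) (cong (λ W → ∣ W ∣ C 3) (∩-idem U))) (⟦edge⟧*C 3 U)

    g-diagonal : ∀ U → g U U ≡ ⟦ edge H U ⟧ * supersetsOfSize 5 U
    g-diagonal U = cong₂ _*_ (⟦⟧-idem (edge H U)) (cong (supersetsOfSize 5) (∪-idem U))

  FF4⇒∑-codegree²≡n*e : IsFF4 H → ∑[ T ∈ allSubsets n ] ⟦ ∣ T ∣ ≡ᵇ 3 ⟧ * (codegree T * codegree T) ≡ n * numEdges H
  FF4⇒∑-codegree²≡n*e ff = +-cancelʳ-≡ K X (n * e) (begin
    X + K             ≡⟨ ∑-codegree²+∑-edgesIn≡∑-edgesIn²+4e ⟩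
    Y + 4 * e         ≡⟨ cong (_+ 4 * e) Y≡2K ⟩
    2 * K + 4 * e     ≡⟨ solve 2 (λ k e → con 2 :* k :+ con 4 :* e := (k :+ con 4 :* e) :+ k) refl K e ⟩
    (K + 4 * e) + K   ≡⟨ cong (_+ K) ∑-edgesIn+4e≡n*e ⟩
    n * e + K         ∎)
    where
    open ≡-Reasoning
    e X K Y : ℕ
    e = numEdges H
    X = ∑[ T ∈ allSubsets n ] ⟦ ∣ T ∣ ≡ᵇ 3 ⟧ * (codegree T * codegree T)
    K = ∑[ S ∈ allSubsets n ] ⟦ ∣ S ∣ ≡ᵇ 5 ⟧ * edgesIn H S
    Y = ∑[ S ∈ allSubsets n ] ⟦ ∣ S ∣ ≡ᵇ 5 ⟧ * (edgesIn H S * edgesIn H S)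
    Y≡2K : Y ≡ 2 * K
    Y≡2K = trans (∑-cong (allSubsets n) (FF4⇒⟦∣S∣≡ᵇ5⟧*edgesIn² ff)) (sym (*-distribˡ-∑ (allSubsets n) 2 _))

  FF4⇒codegree-bound : IsFF4 H → ∀ t → (2 * t + 1) * (4 * numEdges H) ≤ n * numEdges H + t * (t + 1) * (n C 3)
  FF4⇒codegree-bound ff t = begin
    (2 * t + 1) * (4 * numEdges H)                                          ≡⟨ cong ((2 * t + 1) *_) (∑-codegree 3) ⟨
    (2 * t + 1) * (∑[ T ∈ allSubsets n ] w T * codegree T)                   ≡⟨ *-distribˡ-∑ (allSubsets n) (2 * t + 1) _ ⟩
    ∑[ T ∈ allSubsets n ] (2 * t + 1) * (w T * codegree T)                   ≡⟨ ∑-cong (allSubsets n) (λ T → *-Props.x∙yz≈y∙xz (2 * t + 1) (w T) _) ⟩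
    ∑[ T ∈ allSubsets n ] w T * ((2 * t + 1) * codegree T)                   ≤⟨ ∑-mono-≤ (allSubsets n) (λ T → *-monoʳ-≤ (w T) ([2t+1]d≤d²+t[t+1] t (codegree T))) ⟩
    ∑[ T ∈ allSubsets n ] w T * (codegree T * codegree T + t * (t + 1))      ≡⟨ ∑-cong (allSubsets n) (λ T → *-distribˡ-+ (w T) _ _) ⟩
    ∑[ T ∈ allSubsets n ] (w T * (codegree T * codegree T) + w T * (t * (t + 1)))
                                                                             ≡⟨ ∑-distrib-+ (allSubsets n) _ _ ⟩
    (∑[ T ∈ allSubsets n ] w T * (codegree T * codegree T)) + (∑[ T ∈ allSubsets n ] w T * (t * (t + 1)))
                                                                             ≡⟨ cong₂ _+_ (FF4⇒∑-codegree²≡n*e ff) (sym (*-distribʳ-∑ (allSubsets n) _ w)) ⟩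
    n * numEdges H + (∑[ T ∈ allSubsets n ] w T) * (t * (t + 1))             ≡⟨ cong (λ c → n * numEdges H + c * (t * (t + 1))) (∑⟦∣T∣≡ᵇk⟧≡nCk n 3) ⟩
    n * numEdges H + (n C 3) * (t * (t + 1))                                 ≡⟨ cong (n * numEdges H +_) (*-comm (n C 3) _) ⟩
    n * numEdges H + t * (t + 1) * (n C 3)                                   ∎
    where
    open ≤-Reasoning
    w : Subset n → ℕ
    w T = ⟦ ∣ T ∣ ≡ᵇ 3 ⟧

2*[1+m]C2≡[1+m]*m : ∀ m → 2 * (suc m C 2) ≡ suc m * m
2*[1+m]C2≡[1+m]*m zero    = refl
2*[1+m]C2≡[1+m]*m (suc m) = begin
  2 * (suc (suc m) C 2)              ≡⟨ cong (2 *_) (nCk+nC[k+1]≡[n+1]C[k+1] (suc m) 1) ⟨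
  2 * (suc m C 1 + suc m C 2)        ≡⟨ *-distribˡ-+ 2 (suc m C 1) _ ⟩
  2 * (suc m C 1) + 2 * (suc m C 2)  ≡⟨ cong₂ _+_ (cong (2 *_) (nC1≡n (suc m))) (2*[1+m]C2≡[1+m]*m m) ⟩
  2 * suc m + suc m * m              ≡⟨ solve 1 (λ m → con 2 :* (con 1 :+ m) :+ (con 1 :+ m) :* m := (con 2 :+ m) :* (con 1 :+ m)) refl m ⟩
  suc (suc m) * suc m                ∎
  where open ≡-Reasoning

6*[2+m]C3≡[2+m][1+m]m : ∀ m → 6 * (suc (suc m) C 3) ≡ suc (suc m) * suc m * m
6*[2+m]C3≡[2+m][1+m]m zero    = refl
6*[2+m]C3≡[2+m][1+m]m (suc m) = begin
  6 * ((3 + m) C 3)                               ≡⟨ cong (6 *_) (nCk+nC[k+1]≡[n+1]C[k+1] (2 + m) 2) ⟨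
  6 * ((2 + m) C 2 + (2 + m) C 3)                 ≡⟨ *-distribˡ-+ 6 ((2 + m) C 2) _ ⟩
  6 * ((2 + m) C 2) + 6 * ((2 + m) C 3)           ≡⟨ cong (_+ 6 * ((2 + m) C 3)) (*-assoc 3 2 ((2 + m) C 2)) ⟩
  3 * (2 * ((2 + m) C 2)) + 6 * ((2 + m) C 3)     ≡⟨ cong₂ _+_ (cong (3 *_) (2*[1+m]C2≡[1+m]*m (suc m))) (6*[2+m]C3≡[2+m][1+m]m m) ⟩
  3 * ((2 + m) * (1 + m)) + (2 + m) * (1 + m) * m
    ≡⟨ solve 1 (λ m → con 3 :* ((con 2 :+ m) :* (con 1 :+ m)) :+ (con 2 :+ m) :* (con 1 :+ m) :* m := (con 3 :+ m) :* (con 2 :+ m) :* (con 1 :+ m)) refl m ⟩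
  (3 + m) * (2 + m) * (1 + m)                     ∎
  where open ≡-Reasoning

96t[t+1]C[4t+3,3]≡[4t+1]n[n∸1][n∸3][n+1] : ∀ t →
  96 * (t * (t + 1) * ((4 * t + 3) C 3)) ≡
  (1 + 4 * t) * ((4 * t + 3) * ((4 * t + 3) ∸ 1) * ((4 * t + 3) ∸ 3) * ((4 * t + 3) + 1))
96t[t+1]C[4t+3,3]≡[4t+1]n[n∸1][n∸3][n+1] t = begin
  96 * (t * (t + 1) * ((4 * t + 3) C 3))
    ≡⟨ solve 2 (λ t c → con 96 :* (t :* (t :+ con 1) :* c) := con 16 :* t :* (t :+ con 1) :* (con 6 :* c)) refl t _ ⟩
  16 * t * (t + 1) * (6 * ((4 * t + 3) C 3))
    ≡⟨ cong (λ m → 16 * t * (t + 1) * (6 * (m C 3))) (+-comm (4 * t) 3) ⟩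
  16 * t * (t + 1) * (6 * ((3 + 4 * t) C 3))
    ≡⟨ cong (16 * t * (t + 1) *_) (6*[2+m]C3≡[2+m][1+m]m (1 + 4 * t)) ⟩
  16 * t * (t + 1) * ((3 + 4 * t) * (2 + 4 * t) * (1 + 4 * t))
    ≡⟨ solve 1 (λ t → con 16 :* t :* (t :+ con 1) :* ((con 3 :+ con 4 :* t) :* (con 2 :+ con 4 :* t) :* (con 1 :+ con 4 :* t))
                    := (con 1 :+ con 4 :* t) :* ((con 4 :* t :+ con 3) :* (con 4 :* t :+ con 2) :* (con 4 :* t) :* ((con 4 :* t :+ con 3) :+ con 1))) refl t ⟩
  (1 + 4 * t) * ((4 * t + 3) * (4 * t + 2) * (4 * t) * ((4 * t + 3) + 1))
    ≡⟨ cong₂ (λ a b → (1 + 4 * t) * ((4 * t + 3) * a * b * ((4 * t + 3) + 1))) (+-∸-assoc (4 * t) {3} {1} (s≤s z≤n)) (m+n∸n≡m (4 * t) 3) ⟨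
  (1 + 4 * t) * ((4 * t + 3) * ((4 * t + 3) ∸ 1) * ((4 * t + 3) ∸ 3) * ((4 * t + 3) + 1))
    ∎
  where open ≡-Reasoning

proposition2 : (t : ℕ) (H : Hypergraph4 (4 * t + 3)) → IsFF4 H →
    96 * numEdges H ≤ (4 * t + 3) * ((4 * t + 3) ∸ 1) * ((4 * t + 3) ∸ 3) * ((4 * t + 3) + 1)
proposition2 t H ff = *-cancelˡ-≤ (1 + 4 * t) (begin
  (1 + 4 * t) * (96 * e)                  ≡⟨ regroup t e ⟩
  96 * ((4 * t + 1) * e)                  ≤⟨ *-monoʳ-≤ 96 [4t+1]e≤t[t+1]C ⟩
  96 * (t * (t + 1) * ((4 * t + 3) C 3))  ≡⟨ 96t[t+1]C[4t+3,3]≡[4t+1]n[n∸1][n∸3][n+1] t ⟩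
  (1 + 4 * t) * ((4 * t + 3) * ((4 * t + 3) ∸ 1) * ((4 * t + 3) ∸ 3) * ((4 * t + 3) + 1))  ∎)
  where
  open ≤-Reasoning
  e = numEdges H
  regroup : ∀ t e → (1 + 4 * t) * (96 * e) ≡ 96 * ((4 * t + 1) * e)
  regroup = solve 2 (λ t e → (con 1 :+ con 4 :* t) :* (con 96 :* e) := con 96 :* ((con 4 :* t :+ con 1) :* e)) refl
  split-4e : ∀ t e → (2 * t + 1) * (4 * e) ≡ (4 * t + 3) * e + (4 * t + 1) * e
  split-4e = solve 2 (λ t e → (con 2 :* t :+ con 1) :* (con 4 :* e) := (con 4 :* t :+ con 3) :* e :+ (con 4 :* t :+ con 1) :* e) refl
  [4t+1]e≤t[t+1]C : (4 * t + 1) * e ≤ t * (t + 1) * ((4 * t + 3) C 3)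
  [4t+1]e≤t[t+1]C = +-cancelˡ-≤ ((4 * t + 3) * e) _ _ 
    (subst (_≤ (4 * t + 3) * e + t * (t + 1) * ((4 * t + 3) C 3)) (split-4e t e) (FF4⇒codegree-bound H ff t))
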